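{- Let $\tau$ be a countable relational vocabulary containing $=$ and $\neq$, let $B\subseteq Mod(\tau)$ be isomorphism invariant and let $\alpha\geq 1$ be a countable ordinal. The set $B$ is $\pmb\Pi^0_\alpha$ in the Scott topology on $Mod(\tau)$ if and only if there is a $\Pi^p_\alpha$ $\tau$-sentence $\varphi$ such that $B=Mod(\varphi)$.
   Context: $Mod(\tau)$ is the set of $\tau$-structures with universe $\omega$, each identified with its atomic diagram $D_\mathcal{A}\in 2^\omega$ (w.r.t. a fixed effective enumeration of atomic formulas, $D_\mathcal{A}(n)=1$ iff the $n$th atomic formula holds with $x_i\mapsto i$). The Scott topology on $2^\omega$ has as basis $2^\omega$, $\emptyset$ and finite intersections of sets $O_n=\{f:f(n)=1\}$; $Mod(\tau)$ has the subspace topology. Borel hierarchy (Selivanov) on a topological space: $\pmb\Sigma^0_1$ = open sets; for $\alpha>1$, $\pmb\Sigma^0_\alpha$ = sets of the form $\bigcup_{i\in\omega}(B_i\setminus B_i')$ with $B_i,B_i'\in\pmb\Sigma^0_{\beta_i}$, $\beta_i<\alpha$; $\pmb\Pi^0_\alpha$ = complements of $\pmb\Sigma^0_\alpha$ sets. Positive infinitary formulas: $\Sigma^p_0$ = finite conjunctions of atomic formulas, $\Pi^p_0$ = finite disjunctions of negated atomic formulas; $\Sigma^p_1$: $\bigvee_{i\in I}\exists\bar x_i\psi_i$ with $\psi_i\in\Sigma^p_0$; $\Pi^p_1$: $\bigwedge_{i\in I}\forall\bar x_i\psi_i$ with $\psi_i\in\Pi^p_0$; for $\alpha\ge2$, $\Sigma^p_\alpha$: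 $\bigvee_{i\in I}\exists\bar x_i(\phi_i\wedge\psi_i)$ and $\Pi^p_\alpha$: $\bigwedge_{i\in I}\forall\bar x_i(\phi_i\vee\psi_i)$, with $\phi_i\in\Sigma^p_{\beta_i}$, $\psi_i\in\Pi^p_{\beta_i}$, $\beta_i<\alpha$, all $I$ countable. -}

module Defs where

open import Level using (Level) renaming (zero to lzero; suc to lsuc)
open import Data.Nat using (ℕ; _+_)
open import Data.Fin using (Fin)
open import Data.Bool using (Bool; true; false)
open import Data.List using (List)
open import Data.List.Relation.Unary.All using (All)
open import Data.List.Relation.Unary.Any using (Any)
open import Data.Vec using (Vec; []; _∷_; map)
import Data.Vec.Functional as VF
open import Data.Product using (Σ; ∃; _×_; _,_)
open import Data.Sum using (_⊎_)
open import Relation.Nullary using (¬_)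
open import Relation.Binary.PropositionalEquality using (_≡_; _≢_)
open import Function.Bundles using (_↣_; _↔_; _⇔_; Inverse)

-- Countable ordinals as Brouwer trees, with their (ordinal-value) order

data Ord : Set where
  oz : Ord
  os : Ord → Ord
  ol : (ℕ → Ord) → Ord

infix 4 _≤ₒ_ _<ₒ_

data _≤ₒ_ : Ord → Ord → Set where
  ≤-zero     : ∀ {x} → oz ≤ₒ x
  ≤-trans    : ∀ {x y z} → x ≤ₒ y → y ≤ₒ z → x ≤ₒ z
  ≤-suc      : ∀ {x y} → x ≤ₒ y → os x ≤ₒ os y
  ≤-cocone   : ∀ {x} (f : ℕ → Ord) (k : ℕ) → x ≤ₒ f k → x ≤ₒ ol f
  ≤-limiting : ∀ {x} (f : ℕ → Ord) → (∀ k → f k ≤ₒ x) → ol f ≤ₒ x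

_<ₒ_ : Ord → Ord → Set
x <ₒ y = os x ≤ₒ y

one two : Ord
one = os oz
two = os one

record Vocabulary : Set₁ where
  field
    Rel       : Set
    arity     : Rel → ℕ
    countable : Rel ↣ ℕ
open Vocabulary public

data Sym (τ : Vocabulary) : Set where
  eqS neqS : Sym τ
  rel      : Rel τ → Sym τ

arityS : ∀ {τ} → Sym τ → ℕ
arityS eqS     = 2
arityS neqS    = 2
arityS {τ} (rel r) = arity τ r

Atom : Vocabulary → Set → Set
Atom τ V = Σ (Sym τ) (λ s → Vec V (arityS s))

Diagram : Vocabulary → Set
Diagram τ = Atom τ ℕ → Bool

IsModel : ∀ {τ} → Diagram τ → Set
IsModel {τ} D = ∀ (i j : ℕ) →
  ((D (eqS , i ∷ j ∷ []) ≡ true) ⇔ (i ≡ j)) ×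
  ((D (neqS , i ∷ j ∷ []) ≡ true) ⇔ (i ≢ j))

-- Mod(τ): τ-structures with universe ω, identified with their diagrams
Struct : Vocabulary → Set
Struct τ = Σ (Diagram τ) IsModel

diag : ∀ {τ} → Struct τ → Diagram τ
diag (D , _) = D

Pred : Vocabulary → Set₁
Pred τ = Struct τ → Set

_≅_ : ∀ {τ} → Struct τ → Struct τ → Set
_≅_ {τ} A A' = Σ (ℕ ↔ ℕ) (λ f → ∀ (s : Sym τ) (v : Vec ℕ (arityS s)) →
  diag A' (s , map (Inverse.to f) v) ≡ diag A (s , v))

IsoInvariant : ∀ {τ} → Pred τ → Set
IsoInvariant {τ} B = ∀ (A A' : Struct τ) → A ≅ A' → B A → B A'

Basic : ∀ {τ} → List (Atom τ ℕ) → Pred τ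
Basic F A = All (λ a → diag A a ≡ true) F

IsOpen : ∀ {τ} → Pred τ → Set₁
IsOpen {τ} U = Σ (List (Atom τ ℕ) → Set) (λ P →
  ∀ (A : Struct τ) → U A ⇔ ∃ (λ F → P F × Basic F A))

data IsΣ⁰ (τ : Vocabulary) : Ord → Pred τ → Set₁ where
  open₁ : ∀ {α U} → one ≤ₒ α → α ≤ₒ one → IsOpen U → IsΣ⁰ τ α U
  union : ∀ {α U} → two ≤ₒ α →
    (β : ℕ → Ord) → (∀ i → one ≤ₒ β i) → (∀ i → β i <ₒ α) →
    (C C' : ℕ → Pred τ) →
    (∀ i → IsΣ⁰ τ (β i) (C i)) → (∀ i → IsΣ⁰ τ (β i) (C' i)) →
    (∀ (A : Struct τ) → U A ⇔ ∃ (λ i → C i A × ¬ C' i A)) →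
    IsΣ⁰ τ α U

IsΠ⁰ : (τ : Vocabulary) → Ord → Pred τ → Set₁
IsΠ⁰ τ α B = Σ (Pred τ) (λ S → IsΣ⁰ τ α S × (∀ (A : Struct τ) → B A ⇔ (¬ S A)))

-- Positive infinitary formulas in context of n free variables (Fin n);
-- ∃ x̄ / ∀ x̄ over a k-tuple extends the context to k + n.
-- Index sets I are countable (injection into ℕ).

data SigP (τ : Vocabulary) : Ord → ℕ → Set₁
data PiP  (τ : Vocabulary) : Ord → ℕ → Set₁

data SigP τ where
  sig0 : ∀ {α n} → α ≤ₒ oz → List (Atom τ (Fin n)) → SigP τ α n
  sig1 : ∀ {α n} → one ≤ₒ α → α ≤ₒ one →
    (I : Set) → I ↣ ℕ → (k : I → ℕ) →
    ((i : I) → List (Atom τ (Fin (k i + n)))) → SigP τ α n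
  sigS : ∀ {α n} → two ≤ₒ α →
    (I : Set) → I ↣ ℕ → (k : I → ℕ) →
    (β : I → Ord) → (∀ i → β i <ₒ α) →
    ((i : I) → SigP τ (β i) (k i + n)) →
    ((i : I) → PiP τ (β i) (k i + n)) → SigP τ α n

data PiP τ where
  pi0 : ∀ {α n} → α ≤ₒ oz → List (Atom τ (Fin n)) → PiP τ α n
  pi1 : ∀ {α n} → one ≤ₒ α → α ≤ₒ one →
    (I : Set) → I ↣ ℕ → (k : I → ℕ) →
    ((i : I) → List (Atom τ (Fin (k i + n)))) → PiP τ α n
  piS : ∀ {α n} → two ≤ₒ α →
    (I : Set) → I ↣ ℕ → (k : I → ℕ) →
    (β : I → Ord) → (∀ i → β i <ₒ α) →
    ((i : I) → SigP τ (β i) (k i + n)) →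
    ((i : I) → PiP τ (β i) (k i + n)) → PiP τ α n

atomVal : ∀ {τ n} → Struct τ → (Fin n → ℕ) → Atom τ (Fin n) → Bool
atomVal A ρ (s , v) = diag A (s , map ρ v)

SatΣ : ∀ {τ α n} → Struct τ → SigP τ α n → (Fin n → ℕ) → Set
SatΠ : ∀ {τ α n} → Struct τ → PiP τ α n → (Fin n → ℕ) → Set

SatΣ A (sig0 _ as) ρ = All (λ a → atomVal A ρ a ≡ true) as
SatΣ A (sig1 _ _ I _ k ψ) ρ =
  Σ I (λ i → Σ (Fin (k i) → ℕ) (λ x →
    All (λ a → atomVal A (x VF.++ ρ) a ≡ true) (ψ i)))
SatΣ A (sigS _ I _ k β _ φ ψ) ρ =
  Σ I (λ i → Σ (Fin (k i) → ℕ) (λ x →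
    SatΣ A (φ i) (x VF.++ ρ) × SatΠ A (ψ i) (x VF.++ ρ)))

SatΠ A (pi0 _ as) ρ = Any (λ a → atomVal A ρ a ≡ false) as
SatΠ A (pi1 _ _ I _ k ψ) ρ =
  ∀ (i : I) (x : Fin (k i) → ℕ) →
    Any (λ a → atomVal A (x VF.++ ρ) a ≡ false) (ψ i)
SatΠ A (piS _ I _ k β _ φ ψ) ρ =
  ∀ (i : I) (x : Fin (k i) → ℕ) →
    SatΣ A (φ i) (x VF.++ ρ) ⊎ SatΠ A (ψ i) (x VF.++ ρ)

noVars : Fin 0 → ℕ
noVars ()

ModΠ : ∀ {τ α} → PiP τ α 0 → Pred τ
ModΠ φ A = SatΠ A φ noVars

module Submission where

-- A Πᵖ_α sentence defines a Π⁰_α set by induction on formulas: countable disjunctions and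
-- existential quantifiers become countable unions of differences of sets of lower level.
-- Conversely, let the complement S of B be given by a Σ⁰_α code.  A finite injective tuple of
-- elements of A is read as the start of an enumeration of A, i.e. of a copy of A with universe ω,
-- and "the tuple forces S" is defined by recursion on the code; it is expressed, uniformly in A,
-- by a Σᵖ formula, and "no extension of the tuple forces S" by a Πᵖ formula of the same level.
-- An enumeration that is generic, deciding every subcode at some stage, gives a copy of A lying
-- in S exactly when one of its stages forces S.  As B is isomorphism invariant, A ∈ B iff no tuple
-- of A forces S, which is the required Πᵖ_α sentence.

open import Defs
open import Level using (Lift; lift) renaming (zero to lzero; suc to lsuc)
open import Axiom.ExcludedMiddle using (ExcludedMiddle)

open import Data.Nat as ℕ using (ℕ; zero; suc; _+_; _∸_; _≤_; _<_; z≤n; s≤s; _≟_; _⊔_)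
import Data.Nat.Properties as ℕ
open import Data.Fin as Fin using (Fin) renaming (zero to fzero; suc to fsuc)
open import Data.Bool using (Bool; true; false)
import Data.Bool as Bool
open import Data.Bool.Properties using (T-irrelevant; not-¬; ¬-not)
open import Data.List as List using (List; []; _∷_; _++_)
import Data.List.Properties as List
open import Data.List.Relation.Unary.All as All using (All; []; _∷_)
import Data.List.Relation.Unary.All.Properties as All
open import Data.List.Relation.Unary.Any as Any using (Any)
open import Data.Vec as Vec using (Vec; []; _∷_)
import Data.Vec.Properties as Vec
import Data.Vec.Relation.Unary.All as VAll
import Data.Vec.Functional as VF
import Data.Vec.Functional.Properties as VF
open import Data.Product using (Σ; ∃; _×_; _,_; proj₁; proj₂)
open import Data.Sum using (_⊎_; inj₁; inj₂; [_,_]′)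
open import Data.Empty using (⊥; ⊥-elim)
open import Data.Maybe using (Maybe; just; nothing; _>>=_)
open import Relation.Nullary using (¬_; Dec; yes; no)
open import Relation.Nullary.Decidable using (True; toWitness; fromWitness)
open import Relation.Binary.PropositionalEquality
open import Function using (_∘_; const)
open import Function.Bundles using (_⇔_; mk⇔; _↣_; mk↣; mk↔ₛ′; Injection; Equivalence)
open import Function.Construct.Identity using (↣-id)
open import Function.Related.TypeIsomorphisms using (¬-cong-⇔)
open import Function.Properties.Equivalence using () renaming (refl to ⇔-refl; sym to ⇔-sym; trans to ⇔-trans)

open Equivalence using (to; from)

-- unpair n runs through the diagonals a + b = s in turn; the s-th diagonal starts at triangle s.

next : ℕ × ℕ → ℕ × ℕ
next (a , zero)  = zero , suc a
next (a , suc b) = suc a , b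

unpair : ℕ → ℕ × ℕ
unpair zero    = 0 , 0
unpair (suc n) = next (unpair n)

triangle : ℕ → ℕ
triangle zero    = zero
triangle (suc s) = suc (triangle s + s)

pair : ℕ → ℕ → ℕ
pair a b = triangle (a + b) + a

unpair-diagonal : ∀ s → unpair (triangle s) ≡ (0 , s) →
  ∀ a b → a + b ≡ s → unpair (triangle s + a) ≡ (a , b)
unpair-diagonal s start zero b refl = trans (cong unpair (ℕ.+-identityʳ (triangle s))) start
unpair-diagonal s start (suc a) b a+1+b≡s = begin
  unpair (triangle s + suc a)  ≡⟨ cong unpair (ℕ.+-suc (triangle s) a) ⟩
  next (unpair (triangle s + a)) ≡⟨ cong next (unpair-diagonal s start a (suc b) (trans (ℕ.+-suc a b) a+1+b≡s)) ⟩
  (suc a , b)                  ∎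
  where open ≡-Reasoning

unpair-triangle : ∀ s → unpair (triangle s) ≡ (0 , s)
unpair-triangle zero    = refl
unpair-triangle (suc s) = cong next (unpair-diagonal s (unpair-triangle s) s 0 (ℕ.+-identityʳ s))

unpair-pair : ∀ a b → unpair (pair a b) ≡ (a , b)
unpair-pair a b = unpair-diagonal (a + b) (unpair-triangle (a + b)) a b refl

pair-injective : ∀ {a b a′ b′} → pair a b ≡ pair a′ b′ → a ≡ a′ × b ≡ b′
pair-injective {a} {b} {a′} {b′} eq with trans (sym (unpair-pair a b)) (trans (cong unpair eq) (unpair-pair a′ b′))
... | refl = refl , refl

∃-unpair : ∀ {ℓ} (P : ℕ × ℕ → Set ℓ) → ∀ a b → P (a , b) → ∃ λ n → P (unpair n)
∃-unpair P a b h = pair a b , subst P (sym (unpair-pair a b)) h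

encodeVec : ∀ {a} → Vec ℕ a → ℕ
encodeVec []      = 0
encodeVec (x ∷ v) = pair x (encodeVec v)

decodeVec : ∀ a → ℕ → Vec ℕ a
decodeVec zero    n = []
decodeVec (suc a) n = proj₁ (unpair n) ∷ decodeVec a (proj₂ (unpair n))

decodeVec-encodeVec : ∀ {a} (v : Vec ℕ a) → decodeVec a (encodeVec v) ≡ v
decodeVec-encodeVec []      = refl
decodeVec-encodeVec (x ∷ v) rewrite unpair-pair x (encodeVec v) = cong (x ∷_) (decodeVec-encodeVec v)

encodeVec-injective : ∀ {a} {v w : Vec ℕ a} → encodeVec v ≡ encodeVec w → v ≡ w
encodeVec-injective {a} {v} {w} eq = begin
  v                          ≡⟨ decodeVec-encodeVec v ⟨
  decodeVec a (encodeVec v)  ≡⟨ cong (decodeVec a) eq ⟩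
  decodeVec a (encodeVec w)  ≡⟨ decodeVec-encodeVec w ⟩
  w                          ∎
  where open ≡-Reasoning

encodeTuple : ∀ {k} → (Fin k → ℕ) → ℕ
encodeTuple x = encodeVec (Vec.tabulate x)

decodeTuple : ∀ k → ℕ → Fin k → ℕ
decodeTuple k n = Vec.lookup (decodeVec k n)

decodeTuple-encodeTuple : ∀ {k} (x : Fin k → ℕ) → x ≗ decodeTuple k (encodeTuple x)
decodeTuple-encodeTuple {k} x i rewrite decodeVec-encodeVec (Vec.tabulate x) = sym (Vec.lookup∘tabulate x i)

encodeList : List ℕ → ℕ
encodeList xs = pair (List.length xs) (encodeVec (Vec.fromList xs))

decodeList : ℕ → List ℕ
decodeList n = Vec.toList (decodeVec (proj₁ (unpair n)) (proj₂ (unpair n)))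

decodeList-encodeList : ∀ xs → decodeList (encodeList xs) ≡ xs
decodeList-encodeList xs
  rewrite unpair-pair (List.length xs) (encodeVec (Vec.fromList xs))
        | decodeVec-encodeVec (Vec.fromList xs) = Vec.toList∘fromList xs

encodeList-injective : ∀ {xs ys} → encodeList xs ≡ encodeList ys → xs ≡ ys
encodeList-injective {xs} {ys} eq = begin
  xs                         ≡⟨ decodeList-encodeList xs ⟨
  decodeList (encodeList xs) ≡⟨ cong decodeList eq ⟩
  decodeList (encodeList ys) ≡⟨ decodeList-encodeList ys ⟩
  ys                         ∎
  where open ≡-Reasoning

data IsZeroₒ : Ord → Set where
  oz-zero : IsZeroₒ oz
  ol-zero : ∀ f → (∀ k → IsZeroₒ (f k)) → IsZeroₒ (ol f)

IsZeroₒ-≤ : ∀ {x y} → x ≤ₒ y → IsZeroₒ y → IsZeroₒ x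
IsZeroₒ-≤ ≤-zero                _             = oz-zero
IsZeroₒ-≤ (≤-trans x≤y y≤z)     z             = IsZeroₒ-≤ x≤y (IsZeroₒ-≤ y≤z z)
IsZeroₒ-≤ (≤-suc _)             ()
IsZeroₒ-≤ (≤-cocone f k x≤fk)   (ol-zero .f z) = IsZeroₒ-≤ x≤fk (z k)
IsZeroₒ-≤ (≤-limiting f fk≤x)   z             = ol-zero f (λ k → IsZeroₒ-≤ (fk≤x k) z)

one≰oz : ¬ one ≤ₒ oz
one≰oz one≤oz with IsZeroₒ-≤ one≤oz oz-zero
... | ()

one≤one : one ≤ₒ one
one≤one = ≤-suc ≤-zero

two≤⇒one≤ : ∀ {α} → two ≤ₒ α → one ≤ₒ α
two≤⇒one≤ = ≤-trans (≤-suc ≤-zero)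

any-false⇔¬all-true : ∀ {X : Set} (h : X → Bool) (xs : List X) →
  Any (λ a → h a ≡ false) xs ⇔ (¬ All (λ a → h a ≡ true) xs)
any-false⇔¬all-true h xs = ⇔-trans (mk⇔ (Any.map not-¬) (Any.map ¬-not)) (All.Any¬⇔¬All (λ a → h a Bool.≟ true))

++-congʳ : ∀ {m n} (x : Fin m → ℕ) {ρ ρ′ : Fin n → ℕ} → ρ ≗ ρ′ → x VF.++ ρ ≗ x VF.++ ρ′
++-congʳ x = VF.++-cong x x (λ _ → refl)

++-congˡ : ∀ {m n} {x x′ : Fin m → ℕ} (ρ : Fin n → ℕ) → x ≗ x′ → x VF.++ ρ ≗ x′ VF.++ ρ
++-congˡ {x = x} {x′} ρ eq = VF.++-cong x x′ eq (λ _ → refl)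

++-suc : ∀ {m n} (x : Fin (suc m) → ℕ) (ρ : Fin n → ℕ) i → (x VF.++ ρ) (fsuc i) ≡ ((x ∘ fsuc) VF.++ ρ) i
++-suc {m} x ρ i with Fin.splitAt m i
... | inj₁ _ = refl
... | inj₂ _ = refl

-- An assignment of the context Fin k read as a map on positions 0 … k-1 (and 0 beyond): the
-- variable fzero holds the newest position k-1, so prepending fresh variables keeps old positions.
val : ∀ {k} → (Fin k → ℕ) → ℕ → ℕ
val {zero}  ρ j = 0
val {suc k} ρ j with j ≟ k
... | yes _ = ρ fzero
... | no  _ = val (ρ ∘ fsuc) j

val-cong : ∀ {k} {ρ ρ′ : Fin k → ℕ} → ρ ≗ ρ′ → val ρ ≗ val ρ′
val-cong {zero}  eq j = refl
val-cong {suc k} eq j with j ≟ k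
... | yes _ = eq fzero
... | no  _ = val-cong (eq ∘ fsuc) j

val-++-< : ∀ m {k} (x : Fin m → ℕ) (ρ : Fin k → ℕ) j → j < k → val (x VF.++ ρ) j ≡ val ρ j
val-++-< zero    x ρ j j<k = refl
val-++-< (suc m) {k} x ρ j j<k with j ≟ m + k
... | yes refl = ⊥-elim (ℕ.<-irrefl refl (ℕ.<-≤-trans j<k (ℕ.m≤n+m k m)))
... | no  _    = trans (val-cong (++-suc x ρ) j) (val-++-< m (x ∘ fsuc) ρ j j<k)

val-extend : ∀ m {k} (ρ : Fin k → ℕ) (g : ℕ → ℕ) → (∀ j → j < k → g j ≡ val ρ j) →
  Σ (Fin m → ℕ) λ x → ∀ j → j < m + k → val (x VF.++ ρ) j ≡ g j
val-extend zero        ρ g agree = (λ ()) , λ j j<k → sym (agree j j<k)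
val-extend (suc m) {k} ρ g agree = g (m + k) VF.∷ x , extended
  where
  x = proj₁ (val-extend m ρ g agree)
  extended : ∀ j → j < suc m + k → val ((g (m + k) VF.∷ x) VF.++ ρ) j ≡ g j
  extended j j<1+m+k with j ≟ m + k
  ... | yes refl = refl
  ... | no  j≢m+k = trans (val-cong (++-suc (g (m + k) VF.∷ x) ρ) j)
                          (proj₂ (val-extend m ρ g agree) j (ℕ.≤∧≢⇒< (ℕ.≤-pred j<1+m+k) j≢m+k))

var : ∀ {k j} → j < k → Fin k
var {suc k} {j} j<1+k with j ≟ k
... | yes _   = fzero
... | no  j≢k = fsuc (var (ℕ.≤∧≢⇒< (ℕ.≤-pred j<1+k) j≢k))

val-var : ∀ {k j} (ρ : Fin k → ℕ) (j<k : j < k) → val ρ j ≡ ρ (var j<k)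
val-var {suc k} {j} ρ j<1+k with j ≟ k
... | yes _   = refl
... | no  j≢k = val-var (ρ ∘ fsuc) (ℕ.≤∧≢⇒< (ℕ.≤-pred j<1+k) j≢k)

vars : ∀ {k a} {v : Vec ℕ a} → VAll.All (_< k) v → Vec (Fin k) a
vars VAll.[]          = []
vars (j<k VAll.∷ v<k) = var j<k ∷ vars v<k

map-vars : ∀ {k a} {v : Vec ℕ a} (v<k : VAll.All (_< k) v) (ρ : Fin k → ℕ) →
  Vec.map ρ (vars v<k) ≡ Vec.map (val ρ) v
map-vars VAll.[]          ρ = refl
map-vars (j<k VAll.∷ v<k) ρ = cong₂ _∷_ (sym (val-var ρ j<k)) (map-vars v<k ρ)

map-≗-below : ∀ {k a} (v : Vec ℕ a) {f g : ℕ → ℕ} → VAll.All (_< k) v →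
  (∀ j → j < k → f j ≡ g j) → Vec.map f v ≡ Vec.map g v
map-≗-below []      _                 _     = refl
map-≗-below (j ∷ v) (j<k VAll.∷ v<k) agree = cong₂ _∷_ (agree j j<k) (map-≗-below v v<k agree)

InjectiveBelow : ℕ → (ℕ → ℕ) → Set
InjectiveBelow k f = ∀ a b → a < k → b < k → f a ≡ f b → a ≡ b

injectiveBelow-agree : ∀ {k f g} → InjectiveBelow k f → (∀ j → j < k → g j ≡ f j) → InjectiveBelow k g
injectiveBelow-agree inj agree a b a<k b<k eq =
  inj a b a<k b<k (trans (sym (agree a a<k)) (trans eq (agree b b<k)))

injectiveBelow-suc : ∀ {k f} → InjectiveBelow (suc k) f ⇔ ((∀ c → c < k → f c ≢ f k) × InjectiveBelow k f)
injectiveBelow-suc {k} {f} = mk⇔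
  (λ inj → (λ c c<k eq → ℕ.<-irrefl (inj c k (ℕ.m<n⇒m<1+n c<k) (ℕ.n<1+n k) eq) c<k) ,
           (λ a b a<k b<k → inj a b (ℕ.m<n⇒m<1+n a<k) (ℕ.m<n⇒m<1+n b<k)))
  (λ (fresh , inj) → extend fresh inj)
  where
  extend : (∀ c → c < k → f c ≢ f k) → InjectiveBelow k f → InjectiveBelow (suc k) f
  extend fresh inj a b a<1+k b<1+k eq with ℕ.m<1+n⇒m<n∨m≡n a<1+k | ℕ.m<1+n⇒m<n∨m≡n b<1+k
  ... | inj₁ a<k  | inj₁ b<k  = inj a b a<k b<k eq
  ... | inj₁ a<k  | inj₂ refl = ⊥-elim (fresh a a<k eq)
  ... | inj₂ refl | inj₁ b<k  = ⊥-elim (fresh b b<k (sym eq))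
  ... | inj₂ refl | inj₂ refl = refl

Extends : ℕ → (ℕ → ℕ) → ℕ → (ℕ → ℕ) → Set
Extends k f k′ g = k ≤ k′ × (∀ j → j < k → g j ≡ f j)

extends-refl : ∀ {k f} → Extends k f k f
extends-refl = ℕ.≤-refl , λ _ _ → refl

extends-trans : ∀ {k f k′ g k″ h} → Extends k f k′ g → Extends k′ g k″ h → Extends k f k″ h
extends-trans (k≤k′ , g≈f) (k′≤k″ , h≈g) =
  ℕ.≤-trans k≤k′ k′≤k″ , λ j j<k → trans (h≈g j (ℕ.<-≤-trans j<k k≤k′)) (g≈f j j<k)

update : (ℕ → ℕ) → ℕ → ℕ → ℕ → ℕ
update f k v j with j ≟ k
... | yes _ = v
... | no  _ = f j

update-< : ∀ f {k} v {j} → j < k → update f k v j ≡ f j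
update-< f {k} v {j} j<k with j ≟ k
... | yes refl = ⊥-elim (ℕ.<-irrefl refl j<k)
... | no  _    = refl

update-≡ : ∀ f k v → update f k v k ≡ v
update-≡ f k v with k ≟ k
... | yes _   = refl
... | no  k≢k = ⊥-elim (k≢k refl)

update-extends : ∀ {k f} v → Extends k f (suc k) (update f k v)
update-extends {f = f} v = ℕ.n≤1+n _ , λ j → update-< f v

update-injective : ∀ {k f v} → InjectiveBelow k f → (∀ j → j < k → f j ≢ v) → InjectiveBelow (suc k) (update f k v)
update-injective {k} {f} {v} inj fresh = from injectiveBelow-suc
  ( (λ c c<k eq → fresh c c<k (trans (sym (update-< f v c<k)) (trans eq (update-≡ f k v))))
  , injectiveBelow-agree inj (λ j → update-< f v) )

maxBelow : ℕ → (ℕ → ℕ) → ℕ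
maxBelow zero    f = 0
maxBelow (suc k) f = f k ⊔ maxBelow k f

maxBelow-≥ : ∀ k f {j} → j < k → f j ≤ maxBelow k f
maxBelow-≥ (suc k) f j<1+k with ℕ.m<1+n⇒m<n∨m≡n j<1+k
... | inj₁ j<k  = ℕ.≤-trans (maxBelow-≥ k f j<k) (ℕ.m≤n⊔m (f k) (maxBelow k f))
... | inj₂ refl = ℕ.m≤m⊔n (f k) (maxBelow k f)

module _ {τ : Vocabulary} where

  rename : ∀ {X Y : Set} → (X → Y) → Atom τ X → Atom τ Y
  rename σ (s , v) = s , Vec.map σ v

  atomVal-cong : ∀ {n} (A : Struct τ) {ρ ρ′ : Fin n → ℕ} → ρ ≗ ρ′ → ∀ a → atomVal A ρ a ≡ atomVal A ρ′ a
  atomVal-cong A eq (s , v) = cong (λ w → diag A (s , w)) (Vec.map-cong eq v)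

  SatΣ-cong : ∀ {β n} (A : Struct τ) (φ : SigP τ β n) {ρ ρ′ : Fin n → ℕ} → ρ ≗ ρ′ → SatΣ A φ ρ → SatΣ A φ ρ′
  SatΠ-cong : ∀ {β n} (A : Struct τ) (φ : PiP τ β n) {ρ ρ′ : Fin n → ℕ} → ρ ≗ ρ′ → SatΠ A φ ρ → SatΠ A φ ρ′
  SatΣ-cong A (sig0 _ as) eq sat =
    All.map (λ {a} → trans (sym (atomVal-cong A eq a))) sat
  SatΣ-cong A (sig1 _ _ _ _ _ ψ) eq (i , x , sat) =
    i , x , All.map (λ {a} → trans (sym (atomVal-cong A (++-congʳ x eq) a))) sat
  SatΣ-cong A (sigS _ _ _ _ _ _ φ ψ) eq (i , x , satφ , satψ) =
    i , x , SatΣ-cong A (φ i) (++-congʳ x eq) satφ , SatΠ-cong A (ψ i) (++-congʳ x eq) satψ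
  SatΠ-cong A (pi0 _ as) eq sat =
    Any.map (λ {a} → trans (sym (atomVal-cong A eq a))) sat
  SatΠ-cong A (pi1 _ _ _ _ _ ψ) eq sat i x =
    Any.map (λ {a} → trans (sym (atomVal-cong A (++-congʳ x eq) a))) (sat i x)
  SatΠ-cong A (piS _ _ _ _ _ _ φ ψ) eq sat i x with sat i x
  ... | inj₁ satφ = inj₁ (SatΣ-cong A (φ i) (++-congʳ x eq) satφ)
  ... | inj₂ satψ = inj₂ (SatΠ-cong A (ψ i) (++-congʳ x eq) satψ)

  Bounded : ℕ → List (Atom τ ℕ) → Set
  Bounded k = All (λ a → VAll.All (_< k) (proj₂ a))

  bounded-mono : ∀ {k k′} → k ≤ k′ → ∀ {F} → Bounded k F → Bounded k′ F
  bounded-mono k≤k′ = All.map (VAll.map (λ j<k → ℕ.<-≤-trans j<k k≤k′))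

  vec-bounded : ∀ {a} (v : Vec ℕ a) → ∃ λ k → VAll.All (_< k) v
  vec-bounded []      = 0 , VAll.[]
  vec-bounded (j ∷ v) with vec-bounded v
  ... | k , v<k = suc j ⊔ k , ℕ.m≤m⊔n (suc j) k VAll.∷ VAll.map (λ j′<k → ℕ.<-≤-trans j′<k (ℕ.m≤n⊔m (suc j) k)) v<k

  bounded-exists : ∀ F → ∃ λ k → Bounded k F
  bounded-exists []            = 0 , []
  bounded-exists ((_ , v) ∷ F) with vec-bounded v | bounded-exists F
  ... | k , v<k | k′ , F<k′ =
    k ⊔ k′ , VAll.map (λ j<k → ℕ.<-≤-trans j<k (ℕ.m≤m⊔n k k′)) v<k ∷ bounded-mono (ℕ.m≤n⊔m k k′) F<k′

  translate : ∀ {k F} → Bounded k F → List (Atom τ (Fin k))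
  translate {F = []}          []         = []
  translate {F = (s , _) ∷ _} (v<k ∷ bs) = (s , vars v<k) ∷ translate bs

  distinctFrom : ℕ → ℕ → List (Atom τ ℕ)
  distinctFrom zero    b = []
  distinctFrom (suc a) b = (neqS , a ∷ b ∷ []) ∷ distinctFrom a b

  distinctAtoms : ℕ → List (Atom τ ℕ)
  distinctAtoms zero    = []
  distinctAtoms (suc k) = distinctFrom k k ++ distinctAtoms k

  bounded-distinctFrom : ∀ a b → a ≤ b → Bounded (suc b) (distinctFrom a b)
  bounded-distinctFrom zero    b _     = []
  bounded-distinctFrom (suc a) b a<b =
    (ℕ.m<n⇒m<1+n a<b VAll.∷ ℕ.n<1+n b VAll.∷ VAll.[]) ∷ bounded-distinctFrom a b (ℕ.<⇒≤ a<b)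

  bounded-distinctAtoms : ∀ k → Bounded k (distinctAtoms k)
  bounded-distinctAtoms zero    = []
  bounded-distinctAtoms (suc k) =
    All.++⁺ (bounded-distinctFrom k k ℕ.≤-refl) (bounded-mono (ℕ.n≤1+n k) (bounded-distinctAtoms k))

  Realize : Struct τ → (ℕ → ℕ) → List (Atom τ ℕ) → Set
  Realize A f = All (λ a → diag A (rename f a) ≡ true)

  realize-agree : ∀ (A : Struct τ) {k F} {f g : ℕ → ℕ} → Bounded k F → (∀ j → j < k → g j ≡ f j) →
    Realize A f F → Realize A g F
  realize-agree A []                           _     _  = []
  realize-agree A {F = (s , v) ∷ _} (v<k ∷ bs) agree (r ∷ rs) =
    trans (cong (λ w → diag A (s , w)) (map-≗-below v v<k agree)) r ∷ realize-agree A bs agree rs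

  realize-translate : ∀ (A : Struct τ) {k F} (bs : Bounded k F) (ρ : Fin k → ℕ) →
    All (λ a → atomVal A ρ a ≡ true) (translate bs) ⇔ Realize A (val ρ) F
  realize-translate A []                         ρ = mk⇔ (const []) (const [])
  realize-translate A {F = (s , _) ∷ _} (v<k ∷ bs) ρ = mk⇔
    (λ { (r ∷ rs) → trans (sym same) r ∷ to (realize-translate A bs ρ) rs })
    (λ { (r ∷ rs) → trans same r ∷ from (realize-translate A bs ρ) rs })
    where
    same = cong (λ w → diag A (s , w)) (map-vars v<k ρ)

  realize-distinctFrom : ∀ (A : Struct τ) f a b → Realize A f (distinctFrom a b) ⇔ (∀ c → c < a → f c ≢ f b)
  realize-distinctFrom A f zero    b = mk⇔ (λ _ _ ()) (const [])
  realize-distinctFrom A f (suc a) b = mk⇔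
    (λ { (r ∷ rs) c c<1+a → [ (λ c<a → to (realize-distinctFrom A f a b) rs c c<a)
                             , (λ { refl → to (neq⇔≢ (f c) (f b)) r }) ]′ (ℕ.m<1+n⇒m<n∨m≡n c<1+a) })
    (λ h → from (neq⇔≢ (f a) (f b)) (h a (ℕ.n<1+n a)) ∷
           from (realize-distinctFrom A f a b) (λ c c<a → h c (ℕ.m<n⇒m<1+n c<a)))
    where
    neq⇔≢ : ∀ i j → (diag A (neqS , i ∷ j ∷ []) ≡ true) ⇔ (i ≢ j)
    neq⇔≢ i j = proj₂ (proj₂ A i j)

  realize-distinctAtoms : ∀ (A : Struct τ) k f → Realize A f (distinctAtoms k) ⇔ InjectiveBelow k f
  realize-distinctAtoms A zero    f = mk⇔ (λ _ _ _ ()) (const [])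
  realize-distinctAtoms A (suc k) f = mk⇔
    (λ r → from injectiveBelow-suc
      ( to (realize-distinctFrom A f k k) (All.++⁻ˡ (distinctFrom k k) r)
      , to (realize-distinctAtoms A k f) (All.++⁻ʳ (distinctFrom k k) r)))
    (λ inj → All.++⁺ (from (realize-distinctFrom A f k k) (proj₁ (to injectiveBelow-suc inj)))
                     (from (realize-distinctAtoms A k f) (proj₂ (to injectiveBelow-suc inj))))

  sat-pi0⇔¬sig0 : ∀ {α n} (A : Struct τ) (α≤oz : α ≤ₒ oz) (as : List (Atom τ (Fin n))) (ρ : Fin n → ℕ) →
    SatΠ A (pi0 α≤oz as) ρ ⇔ (¬ SatΣ A (sig0 α≤oz as) ρ)
  sat-pi0⇔¬sig0 A _ as ρ = any-false⇔¬all-true (atomVal A ρ) as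

  sat-pi1⇔¬sig1 : ∀ {α n} (A : Struct τ) (one≤α : one ≤ₒ α) (α≤one : α ≤ₒ one) (I : Set) (I↣ℕ : I ↣ ℕ)
    (k : I → ℕ) (ψ : (i : I) → List (Atom τ (Fin (k i + n)))) (ρ : Fin n → ℕ) →
    SatΠ A (pi1 one≤α α≤one I I↣ℕ k ψ) ρ ⇔ (¬ SatΣ A (sig1 one≤α α≤one I I↣ℕ k ψ) ρ)
  sat-pi1⇔¬sig1 A _ _ _ _ _ ψ ρ = mk⇔
    (λ sat (i , x , all) → to (any-false⇔¬all-true (atomVal A (x VF.++ ρ)) (ψ i)) (sat i x) all)
    (λ ¬sat i x → from (any-false⇔¬all-true (atomVal A (x VF.++ ρ)) (ψ i)) (λ all → ¬sat (i , x , all)))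

  encodeSym : Sym τ → ℕ
  encodeSym eqS     = 0
  encodeSym neqS    = 1
  encodeSym (rel r) = suc (suc (Injection.to (countable τ) r))

  encodeSym-injective : ∀ {s s′} → encodeSym s ≡ encodeSym s′ → s ≡ s′
  encodeSym-injective {eqS}   {eqS}    _  = refl
  encodeSym-injective {neqS}  {neqS}   _  = refl
  encodeSym-injective {rel r} {rel r′} eq =
    cong rel (Injection.injective (countable τ) (ℕ.suc-injective (ℕ.suc-injective eq)))
  encodeSym-injective {eqS}   {neqS}   ()
  encodeSym-injective {eqS}   {rel _}  ()
  encodeSym-injective {neqS}  {eqS}    ()
  encodeSym-injective {neqS}  {rel _}  ()
  encodeSym-injective {rel _} {eqS}    ()
  encodeSym-injective {rel _} {neqS}   ()

  encodeAtom : Atom τ ℕ → ℕ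
  encodeAtom (s , v) = pair (encodeSym s) (encodeVec v)

  encodeAtom-injective : ∀ {a b} → encodeAtom a ≡ encodeAtom b → a ≡ b
  encodeAtom-injective {s , v} {s′ , v′} eq with pair-injective eq
  ... | same-sym , same-vec with encodeSym-injective {s} {s′} same-sym
  ...   | refl = cong (s ,_) (encodeVec-injective same-vec)

  encodeAtoms : List (Atom τ ℕ) → ℕ
  encodeAtoms = encodeList ∘ List.map encodeAtom

  encodeAtoms-injective : ∀ {F G} → encodeAtoms F ≡ encodeAtoms G → F ≡ G
  encodeAtoms-injective = List.map-injective encodeAtom-injective ∘ encodeList-injective

module Classical (em : ExcludedMiddle (lsuc lzero)) (τ : Vocabulary) where

  decide : (P : Set) → Dec P
  decide P with em {Lift (lsuc lzero) P}
  ... | yes (lift p) = yes p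
  ... | no ¬p        = no (¬p ∘ lift)

  ¬¬-elim : {P : Set} → ¬ ¬ P → P
  ¬¬-elim {P} ¬¬p with decide P
  ... | yes p = p
  ... | no ¬p = ⊥-elim (¬¬p ¬p)

  decodeIndex : {I : Set} → I ↣ ℕ → ℕ → Maybe I
  decodeIndex {I} e n with decide (Σ I λ i → Injection.to e i ≡ n)
  ... | yes (i , _) = just i
  ... | no  _       = nothing

  decodeIndex-to : {I : Set} (e : I ↣ ℕ) (i : I) → decodeIndex e (Injection.to e i) ≡ just i
  decodeIndex-to {I} e i with decide (Σ I λ i′ → Injection.to e i′ ≡ Injection.to e i)
  ... | yes (i′ , eq) = cong just (Injection.injective e eq)
  ... | no  ∄i        = ⊥-elim (∄i (i , refl))

  IsΣ⁰-resp : ∀ {α} {U V : Pred τ} → IsΣ⁰ τ α U → (∀ A → U A ⇔ V A) → IsΣ⁰ τ α V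
  IsΣ⁰-resp (open₁ a b (P , U⇔)) U⇔V = open₁ a b (P , λ A → ⇔-trans (⇔-sym (U⇔V A)) (U⇔ A))
  IsΣ⁰-resp (union t β o β< C C′ c c′ U⇔) U⇔V = union t β o β< C C′ c c′ (λ A → ⇔-trans (⇔-sym (U⇔V A)) (U⇔ A))

  ∅-open : IsOpen {τ} (const ⊥)
  ∅-open = const ⊥ , λ A → mk⇔ (λ ()) (λ { (_ , () , _) })

  -- Σᵖ₀ formulas define open sets, although the hierarchy has no level 0.
  IsΣ⁰ᵒ : Ord → Pred τ → Set₁
  IsΣ⁰ᵒ β U = (one ≤ₒ β → IsΣ⁰ τ β U) × (¬ one ≤ₒ β → IsOpen U)

  record Σ⁰Difference (α : Ord) (C C′ : Pred τ) : Set₁ where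
    field
      level     : Ord
      one≤level : one ≤ₒ level
      level<α   : level <ₒ α
      Σ⁰-C      : IsΣ⁰ τ level C
      Σ⁰-C′     : IsΣ⁰ τ level C′

  Σ⁰Difference-lift : ∀ {α β C C′} → two ≤ₒ α → β <ₒ α → IsΣ⁰ᵒ β C → IsΣ⁰ᵒ β C′ → Σ⁰Difference α C C′
  Σ⁰Difference-lift {β = β} two≤α β<α (C-Σ⁰ , C-open) (C′-Σ⁰ , C′-open) with decide (one ≤ₒ β)
  ... | yes one≤β = record { level = β ; one≤level = one≤β ; level<α = β<α ; Σ⁰-C = C-Σ⁰ one≤β ; Σ⁰-C′ = C′-Σ⁰ one≤β }
  ... | no  one≰β = record { level = one ; one≤level = one≤one ; level<α = two≤α
                           ; Σ⁰-C = open₁ one≤one one≤one (C-open one≰β) ; Σ⁰-C′ = open₁ one≤one one≤one (C′-open one≰β) }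

  Σ⁰Difference-∅ : ∀ {α} → two ≤ₒ α → Σ⁰Difference α (const ⊥) (const ⊥)
  Σ⁰Difference-∅ two≤α = record { level = one ; one≤level = one≤one ; level<α = two≤α
                                ; Σ⁰-C = open₁ one≤one one≤one ∅-open ; Σ⁰-C′ = open₁ one≤one one≤one ∅-open }

  Σ⁰-⋃-differences : ∀ {α} → two ≤ₒ α → (C C′ : ℕ → Pred τ) → (∀ n → Σ⁰Difference α (C n) (C′ n)) →
    IsΣ⁰ τ α (λ A → ∃ λ n → C n A × ¬ C′ n A)
  Σ⁰-⋃-differences two≤α C C′ d = union two≤α (level ∘ d) (one≤level ∘ d) (level<α ∘ d) C C′
    (Σ⁰-C ∘ d) (Σ⁰-C′ ∘ d) (λ A → ⇔-refl)
    where open Σ⁰Difference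

  Σ⁰-⋃-tuples : ∀ {α} → two ≤ₒ α → {I : Set} → I ↣ ℕ → (k : I → ℕ) →
    (C C′ : (i : I) → (Fin (k i) → ℕ) → Pred τ) → (∀ i x → Σ⁰Difference α (C i x) (C′ i x)) →
    (∀ i {x x′} → x ≗ x′ → ∀ A → C i x A → C i x′ A) → (∀ i {x x′} → x ≗ x′ → ∀ A → C′ i x A → C′ i x′ A) →
    IsΣ⁰ τ α (λ A → Σ I λ i → Σ (Fin (k i) → ℕ) λ x → C i x A × ¬ C′ i x A)
  Σ⁰-⋃-tuples {α} two≤α {I} I↣ℕ k C C′ d C-resp C′-resp =
    IsΣ⁰-resp (Σ⁰-⋃-differences two≤α (Cᵢ ∘ code) (C′ᵢ ∘ code) (piece ∘ code)) same-union
    where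
    decodeCode : ℕ × ℕ → Maybe I × ℕ
    decodeCode (a , l) = decodeIndex I↣ℕ a , l

    code : ℕ → Maybe I × ℕ
    code = decodeCode ∘ unpair

    Cᵢ C′ᵢ : Maybe I × ℕ → Pred τ
    Cᵢ  (nothing , _) = const ⊥
    Cᵢ  (just i  , l) = C i (decodeTuple (k i) l)
    C′ᵢ (nothing , _) = const ⊥
    C′ᵢ (just i  , l) = C′ i (decodeTuple (k i) l)

    InDifference : Struct τ → Maybe I × ℕ → Set
    InDifference A c = Cᵢ c A × ¬ C′ᵢ c A

    piece : ∀ c → Σ⁰Difference α (Cᵢ c) (C′ᵢ c)
    piece (nothing , _) = Σ⁰Difference-∅ two≤α
    piece (just i  , l) = d i _

    found : ∀ A c → InDifference A c → Σ I λ i → Σ (Fin (k i) → ℕ) λ x → C i x A × ¬ C′ i x A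
    found A (just i , l) (c , ¬c′) = i , decodeTuple (k i) l , c , ¬c′

    same-union : ∀ A → (∃ λ n → InDifference A (code n)) ⇔ (Σ I λ i → Σ (Fin (k i) → ℕ) λ x → C i x A × ¬ C′ i x A)
    same-union A = mk⇔ (λ (n , in-n) → found A (code n) in-n)
      λ (i , x , c , ¬c′) → ∃-unpair (InDifference A ∘ decodeCode) (Injection.to I↣ℕ i) (encodeTuple x)
        (subst (λ mi → InDifference A (mi , encodeTuple x)) (sym (decodeIndex-to I↣ℕ i))
          (C-resp i (decodeTuple-encodeTuple x) A c , ¬c′ ∘ C′-resp i (sym ∘ decodeTuple-encodeTuple x) A))

  IsΣ⁰ᵒ-Σ⁰ : ∀ {β U} → one ≤ₒ β → IsΣ⁰ τ β U → IsΣ⁰ᵒ β U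
  IsΣ⁰ᵒ-Σ⁰ one≤β U-Σ⁰ = const U-Σ⁰ , λ one≰β → ⊥-elim (one≰β one≤β)

  IsΣ⁰ᵒ-open : ∀ {β U} → β ≤ₒ oz → IsOpen U → IsΣ⁰ᵒ β U
  IsΣ⁰ᵒ-open β≤oz U-open = (λ one≤β → ⊥-elim (one≰oz (≤-trans one≤β β≤oz))) , const U-open

  record CoΣ⁰ᵒ (β : Ord) (P : Pred τ) : Set₁ where
    field
      complement     : Pred τ
      Σ⁰ᵒ-complement : IsΣ⁰ᵒ β complement
      ⇔¬complement   : ∀ A → P A ⇔ (¬ complement A)
  open CoΣ⁰ᵒ

  complement-mono : ∀ {β β′ P P′} (c : CoΣ⁰ᵒ β P) (c′ : CoΣ⁰ᵒ β′ P′) → (∀ A → P′ A → P A) →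
    ∀ A → complement c A → complement c′ A
  complement-mono c c′ P′⊆P A in-c = ¬¬-elim λ ∉c′ →
    to (⇔¬complement c A) (P′⊆P A (from (⇔¬complement c′ A) ∉c′)) in-c

  open-sig0 : ∀ {α n} (α≤oz : α ≤ₒ oz) (as : List (Atom τ (Fin n))) (ρ : Fin n → ℕ) →
    IsOpen (λ A → SatΣ A (sig0 α≤oz as) ρ)
  open-sig0 _ as ρ = (_≡ List.map (rename ρ) as) ,
    λ A → mk⇔ (λ sat → _ , refl , All.map⁺ sat) (λ { (_ , refl , basic) → All.map⁻ basic })

  open-sig1 : ∀ {α n} (one≤α : one ≤ₒ α) (α≤one : α ≤ₒ one) (I : Set) (I↣ℕ : I ↣ ℕ) (k : I → ℕ)
    (ψ : (i : I) → List (Atom τ (Fin (k i + n)))) (ρ : Fin n → ℕ) →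
    IsOpen (λ A → SatΣ A (sig1 one≤α α≤one I I↣ℕ k ψ) ρ)
  open-sig1 _ _ I _ k ψ ρ = (λ F → Σ I λ i → Σ (Fin (k i) → ℕ) λ x → F ≡ List.map (rename (x VF.++ ρ)) (ψ i)) ,
    λ A → mk⇔ (λ (i , x , sat) → _ , (i , x , refl) , All.map⁺ sat)
              (λ { (_ , (i , x , refl) , basic) → i , x , All.map⁻ basic })

  module Components {I : Set} (k : I → ℕ) (β : I → Ord) {n} (ρ : Fin n → ℕ)
    (φ : (i : I) → SigP τ (β i) (k i + n)) (ψ : (i : I) → PiP τ (β i) (k i + n))
    (coψ : ∀ i x → CoΣ⁰ᵒ (β i) (λ A → SatΠ A (ψ i) (x VF.++ ρ))) where

    Cφ Cψ : (i : I) → (Fin (k i) → ℕ) → Pred τ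
    Cφ i x A = SatΣ A (φ i) (x VF.++ ρ)
    Cψ i x = complement (coψ i x)

    Cφ-resp : ∀ i {x x′} → x ≗ x′ → ∀ A → Cφ i x A → Cφ i x′ A
    Cφ-resp i x≗x′ A = SatΣ-cong A (φ i) (++-congˡ ρ x≗x′)

    Cψ-resp : ∀ i {x x′} → x ≗ x′ → ∀ A → Cψ i x A → Cψ i x′ A
    Cψ-resp i x≗x′ = complement-mono (coψ i _) (coψ i _) (λ A → SatΠ-cong A (ψ i) (++-congˡ ρ (sym ∘ x≗x′)))

  Σᵖ⇒Σ⁰ᵒ : ∀ {β n} (φ : SigP τ β n) (ρ : Fin n → ℕ) → IsΣ⁰ᵒ β (λ A → SatΣ A φ ρ)
  Πᵖ⇒CoΣ⁰ᵒ : ∀ {β n} (ψ : PiP τ β n) (ρ : Fin n → ℕ) → CoΣ⁰ᵒ β (λ A → SatΠ A ψ ρ)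

  Σᵖ⇒Σ⁰ᵒ (sig0 α≤oz as) ρ = IsΣ⁰ᵒ-open α≤oz (open-sig0 α≤oz as ρ)
  Σᵖ⇒Σ⁰ᵒ (sig1 one≤α α≤one I I↣ℕ k ψ) ρ =
    IsΣ⁰ᵒ-Σ⁰ one≤α (open₁ one≤α α≤one (open-sig1 one≤α α≤one I I↣ℕ k ψ ρ))
  Σᵖ⇒Σ⁰ᵒ (sigS two≤α I I↣ℕ k β β<α φ ψ) ρ =
    IsΣ⁰ᵒ-Σ⁰ (two≤⇒one≤ two≤α) (IsΣ⁰-resp (Σ⁰-⋃-tuples two≤α I↣ℕ k Cφ Cψ difference Cφ-resp Cψ-resp) same)
    where
    coψ : ∀ i x → CoΣ⁰ᵒ (β i) (λ A → SatΠ A (ψ i) (x VF.++ ρ))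
    coψ i x = Πᵖ⇒CoΣ⁰ᵒ (ψ i) (x VF.++ ρ)
    open Components k β ρ φ ψ coψ
    difference : ∀ i x → Σ⁰Difference _ (Cφ i x) (Cψ i x)
    difference i x = Σ⁰Difference-lift two≤α (β<α i) (Σᵖ⇒Σ⁰ᵒ (φ i) (x VF.++ ρ)) (Σ⁰ᵒ-complement (coψ i x))
    same : ∀ A → (Σ I λ i → Σ (Fin (k i) → ℕ) λ x → Cφ i x A × ¬ Cψ i x A) ⇔ SatΣ A (sigS two≤α I I↣ℕ k β β<α φ ψ) ρ
    same A = mk⇔ (λ (i , x , satφ , ∉Cψ) → i , x , satφ , from (⇔¬complement (coψ i x) A) ∉Cψ)
                 (λ (i , x , satφ , satψ) → i , x , satφ , to (⇔¬complement (coψ i x) A) satψ)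

  Πᵖ⇒CoΣ⁰ᵒ (pi0 α≤oz as) ρ = record
    { complement = λ A → SatΣ A (sig0 α≤oz as) ρ ; Σ⁰ᵒ-complement = Σᵖ⇒Σ⁰ᵒ (sig0 α≤oz as) ρ
    ; ⇔¬complement = λ A → sat-pi0⇔¬sig0 A α≤oz as ρ }
  Πᵖ⇒CoΣ⁰ᵒ (pi1 one≤α α≤one I I↣ℕ k ψ) ρ = record
    { complement = λ A → SatΣ A (sig1 one≤α α≤one I I↣ℕ k ψ) ρ ; Σ⁰ᵒ-complement = Σᵖ⇒Σ⁰ᵒ (sig1 one≤α α≤one I I↣ℕ k ψ) ρ
    ; ⇔¬complement = λ A → sat-pi1⇔¬sig1 A one≤α α≤one I I↣ℕ k ψ ρ }
  Πᵖ⇒CoΣ⁰ᵒ (piS two≤α I I↣ℕ k β β<α φ ψ) ρ = record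
    { complement = T
    ; Σ⁰ᵒ-complement = IsΣ⁰ᵒ-Σ⁰ (two≤⇒one≤ two≤α) (Σ⁰-⋃-tuples two≤α I↣ℕ k Cψ Cφ difference Cψ-resp Cφ-resp)
    ; ⇔¬complement = same }
    where
    coψ : ∀ i x → CoΣ⁰ᵒ (β i) (λ A → SatΠ A (ψ i) (x VF.++ ρ))
    coψ i x = Πᵖ⇒CoΣ⁰ᵒ (ψ i) (x VF.++ ρ)
    open Components k β ρ φ ψ coψ
    difference : ∀ i x → Σ⁰Difference _ (Cψ i x) (Cφ i x)
    difference i x = Σ⁰Difference-lift two≤α (β<α i) (Σ⁰ᵒ-complement (coψ i x)) (Σᵖ⇒Σ⁰ᵒ (φ i) (x VF.++ ρ))
    T : Pred τ
    T A = Σ I λ i → Σ (Fin (k i) → ℕ) λ x → Cψ i x A × ¬ Cφ i x A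
    disjunct : ∀ A → ¬ T A → ∀ i x → SatΣ A (φ i) (x VF.++ ρ) ⊎ SatΠ A (ψ i) (x VF.++ ρ)
    disjunct A ∉T i x with decide (Cφ i x A)
    ... | yes satφ = inj₁ satφ
    ... | no ¬satφ = inj₂ (from (⇔¬complement (coψ i x) A) (λ inCψ → ∉T (i , x , inCψ , ¬satφ)))
    same : ∀ A → SatΠ A (piS two≤α I I↣ℕ k β β<α φ ψ) ρ ⇔ (¬ T A)
    same A = mk⇔ (λ sat (i , x , inCψ , ¬satφ) → [ ¬satφ , (λ satψ → to (⇔¬complement (coψ i x) A) satψ inCψ) ]′ (sat i x))
                 (disjunct A)

  Πᵖ⇒Π⁰ : ∀ {α} → one ≤ₒ α → (B : Pred τ) → Σ (PiP τ α 0) (λ φ → ∀ A → B A ⇔ ModΠ φ A) → IsΠ⁰ τ α B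
  Πᵖ⇒Π⁰ one≤α B (φ , B⇔φ) =
    complement coφ , proj₁ (Σ⁰ᵒ-complement coφ) one≤α , λ A → ⇔-trans (B⇔φ A) (⇔¬complement coφ A)
    where
    coφ = Πᵖ⇒CoΣ⁰ᵒ φ noVars

  -- Wrapping the side condition in True makes it proof-irrelevant, so F alone determines the index.
  ClauseIndex : (List (Atom τ ℕ) → Set) → ℕ → Set
  ClauseIndex P n = Σ (List (Atom τ ℕ)) λ F → True (decide (P F × Bounded n F))

  -- The inequalities of distinctAtoms make any assignment satisfying a clause injective.
  clause : ∀ {P n} → ClauseIndex P n → List (Atom τ (Fin n))
  clause {n = n} (F , t) = translate (All.++⁺ (bounded-distinctAtoms n) (proj₂ (toWitness t)))

  ExtClauseIndex : (List (Atom τ ℕ) → Set) → ℕ → Set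
  ExtClauseIndex P k = Σ ℕ λ m → ClauseIndex P (m + k)

  clauseIndex-≡ : ∀ {P n} {c c′ : ClauseIndex P n} → proj₁ c ≡ proj₁ c′ → c ≡ c′
  clauseIndex-≡ {c = F , t} {.F , t′} refl = cong (F ,_) (T-irrelevant t t′)

  clauseIndex↣ℕ : ∀ {P n} → ClauseIndex P n ↣ ℕ
  clauseIndex↣ℕ = mk↣ (clauseIndex-≡ ∘ encodeAtoms-injective)

  extClauseIndex-injective : ∀ {P k} {c c′ : ExtClauseIndex P k} →
    pair (proj₁ c) (encodeAtoms (proj₁ (proj₂ c))) ≡ pair (proj₁ c′) (encodeAtoms (proj₁ (proj₂ c′))) → c ≡ c′
  extClauseIndex-injective {c = m , F , _} {m′ , F′ , _} eq
    with pair-injective {m} {encodeAtoms F} {m′} {encodeAtoms F′} eq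
  ... | refl , same = cong (m ,_) (clauseIndex-≡ (encodeAtoms-injective same))

  extClauseIndex↣ℕ : ∀ {P k} → ExtClauseIndex P k ↣ ℕ
  extClauseIndex↣ℕ = mk↣ extClauseIndex-injective

  ℕ×ℕ↣ℕ : (ℕ × ℕ) ↣ ℕ
  ℕ×ℕ↣ℕ = mk↣ injective
    where
    injective : ∀ {p q : ℕ × ℕ} → pair (proj₁ p) (proj₂ p) ≡ pair (proj₁ q) (proj₂ q) → p ≡ q
    injective {a , b} {a′ , b′} eq with pair-injective {a} {b} {a′} {b′} eq
    ... | refl , refl = refl

  forcesΣ            : ∀ {β S} → IsΣ⁰ τ β S → (k : ℕ) → SigP τ β k
  notForcesΠ         : ∀ {β S} → IsΣ⁰ τ β S → (k : ℕ) → PiP τ β k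
  extensionForcesΣ   : ∀ {β S} → IsΣ⁰ τ β S → (k : ℕ) → SigP τ β k
  noExtensionForcesΠ : ∀ {β S} → IsΣ⁰ τ β S → (k : ℕ) → PiP τ β k

  forcesΣ (open₁ a b (P , _)) k = sig1 a b (ClauseIndex P k) clauseIndex↣ℕ (const 0) clause
  forcesΣ (union t β o β< C C′ c c′ _) k =
    sigS t ℕ (↣-id ℕ) (const 0) β β< (λ i → forcesΣ (c i) k) (λ i → noExtensionForcesΠ (c′ i) k)

  notForcesΠ (open₁ a b (P , _)) k = pi1 a b (ClauseIndex P k) clauseIndex↣ℕ (const 0) clause
  notForcesΠ (union t β o β< C C′ c c′ _) k =
    piS t ℕ (↣-id ℕ) (const 0) β β< (λ i → extensionForcesΣ (c′ i) k) (λ i → notForcesΠ (c i) k)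

  extensionForcesΣ (open₁ a b (P , _)) k = sig1 a b (ExtClauseIndex P k) extClauseIndex↣ℕ proj₁ (clause ∘ proj₂)
  extensionForcesΣ (union t β o β< C C′ c c′ _) k =
    sigS t (ℕ × ℕ) ℕ×ℕ↣ℕ proj₁ (β ∘ proj₂) (β< ∘ proj₂)
      (λ (m , i) → forcesΣ (c i) (m + k)) (λ (m , i) → noExtensionForcesΠ (c′ i) (m + k))

  noExtensionForcesΠ (open₁ a b (P , _)) k = pi1 a b (ExtClauseIndex P k) extClauseIndex↣ℕ proj₁ (clause ∘ proj₂)
  noExtensionForcesΠ (union t β o β< C C′ c c′ _) k =
    piS t (ℕ × ℕ) ℕ×ℕ↣ℕ proj₁ (β ∘ proj₂) (β< ∘ proj₂)
      (λ (m , i) → extensionForcesΣ (c′ i) (m + k)) (λ (m , i) → notForcesΠ (c i) (m + k))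

  -- A condition (k , f) over A lists the elements f 0, …, f (k-1) of A, injectively: the start of
  -- an enumeration of A, which presents a copy of A with universe ω.
  module Forcing (A : Struct τ) where

    ForcesOpen : (List (Atom τ ℕ) → Set) → ℕ → (ℕ → ℕ) → Set
    ForcesOpen P k f = InjectiveBelow k f × Σ (List (Atom τ ℕ)) λ F → P F × Bounded k F × Realize A f F

    Forces    : ∀ {β S} → ℕ → (ℕ → ℕ) → IsΣ⁰ τ β S → Set
    ForcesNot : ∀ {β S} → ℕ → (ℕ → ℕ) → IsΣ⁰ τ β S → Set
    Forces k f (open₁ _ _ (P , _))          = ForcesOpen P k f
    Forces k f (union _ _ _ _ _ _ c c′ _) = ∃ λ i → Forces k f (c i) × ForcesNot k f (c′ i)
    ForcesNot k f c = ∀ k′ g → Extends k f k′ g → ¬ Forces k′ g c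

    forces-injective : ∀ {β S} (c : IsΣ⁰ τ β S) {k f} → Forces k f c → InjectiveBelow k f
    forces-injective (open₁ _ _ _)             = proj₁
    forces-injective (union _ _ _ _ _ _ c _ _) (i , forces , _) = forces-injective (c i) forces

    forces-mono : ∀ {β S} (c : IsΣ⁰ τ β S) {k f k′ g} →
      Forces k f c → Extends k f k′ g → InjectiveBelow k′ g → Forces k′ g c
    forces-mono (open₁ _ _ _) (_ , F , p , bs , r) (k≤k′ , agree) inj =
      inj , F , p , bounded-mono k≤k′ bs , realize-agree A bs agree r
    forces-mono (union _ _ _ _ _ _ c _ _) (i , forces , forcesNot) ext inj =
      i , forces-mono (c i) forces ext inj , λ k″ h ext′ → forcesNot k″ h (extends-trans ext ext′)

    ExtensionForces : ∀ {β S} → IsΣ⁰ τ β S → (k : ℕ) → (Fin k → ℕ) → Set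
    ExtensionForces c k ρ = ∃ λ m → Σ (Fin m → ℕ) λ x → Forces (m + k) (val (x VF.++ ρ)) c

    tuple-extension : ∀ {k} (ρ : Fin k → ℕ) {k′ g} → Extends k (val ρ) k′ g →
      ∃ λ m → Σ (Fin m → ℕ) λ x → m + k ≡ k′ × (∀ j → j < k′ → val (x VF.++ ρ) j ≡ g j)
    tuple-extension {k} ρ {k′} {g} (k≤k′ , agree) =
      k′ ∸ k , x , m+k≡k′ , λ j j<k′ → x-agrees j (subst (j <_) (sym m+k≡k′) j<k′)
      where
      m+k≡k′ = ℕ.m∸n+n≡m k≤k′
      x = proj₁ (val-extend (k′ ∸ k) ρ g agree)
      x-agrees = proj₂ (val-extend (k′ ∸ k) ρ g agree)

    forcesNot⇔¬extensionForces : ∀ {β S} (c : IsΣ⁰ τ β S) k (ρ : Fin k → ℕ) →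
      ForcesNot k (val ρ) c ⇔ (¬ ExtensionForces c k ρ)
    forcesNot⇔¬extensionForces c k ρ = mk⇔
      (λ forcesNot (m , x , forces) → forcesNot (m + k) _ (ℕ.m≤n+m k m , val-++-< m x ρ) forces)
      refute
      where
      refute : ¬ ExtensionForces c k ρ → ForcesNot k (val ρ) c
      refute ¬ext k′ g ext forces with tuple-extension ρ ext
      ... | m , x , refl , agrees = ¬ext (m , x , forces-mono c forces (ℕ.≤-refl , agrees)
                                                    (injectiveBelow-agree (forces-injective c forces) agrees))

    sat-clause : ∀ P n (ρ : Fin n → ℕ) →
      (Σ (ClauseIndex P n) λ c → All (λ a → atomVal A ρ a ≡ true) (clause c)) ⇔ ForcesOpen P n (val ρ)
    sat-clause P n ρ = mk⇔ sound complete
      where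
      sound : (Σ (ClauseIndex P n) λ c → All (λ a → atomVal A ρ a ≡ true) (clause c)) → ForcesOpen P n (val ρ)
      sound ((F , t) , sat) =
        to (realize-distinctAtoms A n (val ρ)) (All.++⁻ˡ (distinctAtoms n) r) , F , p , bs , All.++⁻ʳ (distinctAtoms n) r
        where
        p = proj₁ (toWitness t)
        bs = proj₂ (toWitness t)
        r = to (realize-translate A _ ρ) sat
      complete : ForcesOpen P n (val ρ) → Σ (ClauseIndex P n) λ c → All (λ a → atomVal A ρ a ≡ true) (clause c)
      complete (inj , F , p , bs , r) =
        (F , fromWitness (p , bs)) , from (realize-translate A _ ρ) (All.++⁺ (from (realize-distinctAtoms A n (val ρ)) inj) r)

    sat-extensionForcesΣ : ∀ {β S} (c : IsΣ⁰ τ β S) k (ρ : Fin k → ℕ) →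
      SatΣ A (extensionForcesΣ c k) ρ ⇔ (∃ λ m → Σ (Fin m → ℕ) λ x → SatΣ A (forcesΣ c (m + k)) (x VF.++ ρ))
    sat-extensionForcesΣ (open₁ _ _ _) k ρ =
      mk⇔ (λ ((m , i) , x , sat) → m , x , i , (λ ()) , sat) (λ (m , x , i , _ , sat) → (m , i) , x , sat)
    sat-extensionForcesΣ (union _ _ _ _ _ _ _ _ _) k ρ =
      mk⇔ (λ ((m , i) , x , sat) → m , x , i , (λ ()) , sat) (λ (m , x , i , _ , sat) → (m , i) , x , sat)

    sat-noExtensionForcesΠ : ∀ {β S} (c : IsΣ⁰ τ β S) k (ρ : Fin k → ℕ) →
      SatΠ A (noExtensionForcesΠ c k) ρ ⇔ (∀ m (x : Fin m → ℕ) → SatΠ A (notForcesΠ c (m + k)) (x VF.++ ρ))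
    sat-noExtensionForcesΠ (open₁ _ _ _) k ρ =
      mk⇔ (λ sat m x i _ → sat (m , i) x) (λ sat (m , i) x → sat m x i (λ ()))
    sat-noExtensionForcesΠ (union _ _ _ _ _ _ _ _ _) k ρ =
      mk⇔ (λ sat m x i _ → sat (m , i) x) (λ sat (m , i) x → sat m x i (λ ()))

    forcesΣ-correct            : ∀ {β S} (c : IsΣ⁰ τ β S) k (ρ : Fin k → ℕ) →
      SatΣ A (forcesΣ c k) ρ ⇔ Forces k (val ρ) c
    notForcesΠ-correct         : ∀ {β S} (c : IsΣ⁰ τ β S) k (ρ : Fin k → ℕ) →
      SatΠ A (notForcesΠ c k) ρ ⇔ (¬ Forces k (val ρ) c)
    extensionForcesΣ-correct   : ∀ {β S} (c : IsΣ⁰ τ β S) k (ρ : Fin k → ℕ) →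
      SatΣ A (extensionForcesΣ c k) ρ ⇔ ExtensionForces c k ρ
    noExtensionForcesΠ-correct : ∀ {β S} (c : IsΣ⁰ τ β S) k (ρ : Fin k → ℕ) →
      SatΠ A (noExtensionForcesΠ c k) ρ ⇔ ForcesNot k (val ρ) c

    forcesΣ-correct (open₁ _ _ (P , _)) k ρ =
      ⇔-trans (mk⇔ (λ (i , _ , sat) → i , sat) (λ (i , sat) → i , (λ ()) , sat)) (sat-clause P k ρ)
    forcesΣ-correct (union _ _ _ _ _ _ c c′ _) k ρ = mk⇔
      (λ (i , _ , satc , satc′) → i , to (forcesΣ-correct (c i) k ρ) satc , to (noExtensionForcesΠ-correct (c′ i) k ρ) satc′)
      (λ (i , forces , forcesNot) →
        i , (λ ()) , from (forcesΣ-correct (c i) k ρ) forces , from (noExtensionForcesΠ-correct (c′ i) k ρ) forcesNot)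

    notForcesΠ-correct c@(open₁ a b (P , _)) k ρ =
      ⇔-trans (sat-pi1⇔¬sig1 A a b (ClauseIndex P k) clauseIndex↣ℕ (const 0) clause ρ) (¬-cong-⇔ (forcesΣ-correct c k ρ))
    notForcesΠ-correct u@(union _ _ _ _ _ _ c c′ _) k ρ = mk⇔
      (λ sat (i , forces , forcesNot) →
        [ (λ satc′ → to (forcesNot⇔¬extensionForces (c′ i) k ρ) forcesNot (to (extensionForcesΣ-correct (c′ i) k ρ) satc′))
        , (λ satc → to (notForcesΠ-correct (c i) k ρ) satc forces) ]′ (sat i (λ ())))
      (λ ¬forces i _ → disjunct ¬forces i)
      where
      disjunct : ¬ Forces k (val ρ) u → ∀ i → SatΣ A (extensionForcesΣ (c′ i) k) ρ ⊎ SatΠ A (notForcesΠ (c i) k) ρ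
      disjunct ¬forces i with decide (Forces k (val ρ) (c i))
      ... | no ¬forcesc = inj₂ (from (notForcesΠ-correct (c i) k ρ) ¬forcesc)
      ... | yes forcesc = inj₁ (from (extensionForcesΣ-correct (c′ i) k ρ) (¬¬-elim λ ¬ext →
              ¬forces (i , forcesc , from (forcesNot⇔¬extensionForces (c′ i) k ρ) ¬ext)))

    extensionForcesΣ-correct c k ρ = ⇔-trans (sat-extensionForcesΣ c k ρ) (mk⇔
      (λ (m , x , sat) → m , x , to (forcesΣ-correct c (m + k) (x VF.++ ρ)) sat)
      (λ (m , x , forces) → m , x , from (forcesΣ-correct c (m + k) (x VF.++ ρ)) forces))

    noExtensionForcesΠ-correct c k ρ = ⇔-trans (sat-noExtensionForcesΠ c k ρ) (⇔-trans (mk⇔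
      (λ sat (m , x , forces) → to (notForcesΠ-correct c (m + k) (x VF.++ ρ)) (sat m x) forces)
      (λ ¬ext m x → from (notForcesΠ-correct c (m + k) (x VF.++ ρ)) (λ forces → ¬ext (m , x , forces))))
      (⇔-sym (forcesNot⇔¬extensionForces c k ρ)))

    record Condition : Set where
      constructor condition
      field
        size      : ℕ
        enum      : ℕ → ℕ
        injective : InjectiveBelow size enum
    open Condition

    _≼_ : Condition → Condition → Set
    p ≼ q = Extends (size p) (enum p) (size q) (enum q)

    _⊩_ : ∀ {β S} → Condition → IsΣ⁰ τ β S → Set
    p ⊩ c = Forces (size p) (enum p) c

    _⊩¬_ : ∀ {β S} → Condition → IsΣ⁰ τ β S → Set
    p ⊩¬ c = ForcesNot (size p) (enum p) c

    ⊩-mono : ∀ {β S} (c : IsΣ⁰ τ β S) {p q} → p ⊩ c → p ≼ q → q ⊩ c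
    ⊩-mono c {q = q} forces p≼q = forces-mono c forces p≼q (injective q)

    ⊩¬-mono : ∀ {β S} (c : IsΣ⁰ τ β S) {p q} → p ⊩¬ c → p ≼ q → q ⊩¬ c
    ⊩¬-mono c forcesNot p≼q k g ext = forcesNot k g (extends-trans p≼q ext)

    ⊩-⊩¬-disjoint : ∀ {β S} (c : IsΣ⁰ τ β S) {p} → p ⊩ c → ¬ p ⊩¬ c
    ⊩-⊩¬-disjoint c forces forcesNot = forcesNot _ _ extends-refl forces

    ≼-agree : ∀ {p q r j} → p ≼ r → q ≼ r → j < size p → j < size q → enum p j ≡ enum q j
    ≼-agree (_ , r≈p) (_ , r≈q) j<p j<q = trans (sym (r≈p _ j<p)) (r≈q _ j<q)

    append : (p : Condition) (v : ℕ) → (∀ j → j < size p → enum p j ≢ v) → Condition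
    append p v fresh = condition (suc (size p)) (update (enum p) (size p) v) (update-injective (injective p) fresh)

    grow : Condition → Condition
    grow p = append p (suc (maxBelow (size p) (enum p))) fresh
      where
      fresh : ∀ j → j < size p → enum p j ≢ suc (maxBelow (size p) (enum p))
      fresh j j<k eq = ℕ.<-irrefl eq (s≤s (maxBelow-≥ (size p) (enum p) j<k))

    cover : ℕ → Condition → Condition
    cover n p with decide (∃ λ j → j < size p × enum p j ≡ n)
    ... | yes _ = p
    ... | no  ∉ = append p n (λ j j<k eq → ∉ (j , j<k , eq))

    cover-≽ : ∀ n p → p ≼ cover n p
    cover-≽ n p with decide (∃ λ j → j < size p × enum p j ≡ n)
    ... | yes _ = extends-refl
    ... | no  _ = update-extends n

    cover-covers : ∀ n p → ∃ λ j → j < size (cover n p) × enum (cover n p) j ≡ n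
    cover-covers n p with decide (∃ λ j → j < size p × enum p j ≡ n)
    ... | yes covered = covered
    ... | no  _       = size p , ℕ.n<1+n (size p) , update-≡ (enum p) (size p) n

    Σ⁰Code : Set₁
    Σ⁰Code = Σ Ord λ β → Σ (Pred τ) (IsΣ⁰ τ β)

    settle : Maybe Σ⁰Code → Condition → Condition
    settle nothing           p = p
    settle (just (_ , _ , c)) p with decide (Σ Condition λ q → p ≼ q × q ⊩ c)
    ... | yes (q , _) = q
    ... | no  _       = p

    settle-≽ : ∀ mc p → p ≼ settle mc p
    settle-≽ nothing           p = extends-refl
    settle-≽ (just (_ , _ , c)) p with decide (Σ Condition λ q → p ≼ q × q ⊩ c)
    ... | yes (_ , p≼q , _) = p≼q
    ... | no  _             = extends-refl

    settle-decides : ∀ {β S} (c : IsΣ⁰ τ β S) p → settle (just (β , S , c)) p ⊩ c ⊎ settle (just (β , S , c)) p ⊩¬ c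
    settle-decides c p with decide (Σ Condition λ q → p ≼ q × q ⊩ c)
    ... | yes (_ , _ , forces) = inj₁ forces
    ... | no  ∄q               = inj₂ λ k g ext forces → ∄q (condition k g (forces-injective c forces) , ext , forces)

    child : ∀ {β S} → IsΣ⁰ τ β S → ℕ × ℕ → Maybe Σ⁰Code
    child (open₁ _ _ _)                  _          = nothing
    child (union _ β _ _ C _  c _  _) (zero  , i) = just (β i , C i , c i)
    child (union _ β _ _ _ C′ _ c′ _) (suc _ , i) = just (β i , C′ i , c′ i)

    subcode : List ℕ → Σ⁰Code → Maybe Σ⁰Code
    subcode []      code          = just code
    subcode (d ∷ p) (_ , _ , c) = child c (unpair d) >>= subcode p

    -- The stages of a generic enumeration of A: stage n+1 enumerates a further element, makes sure
    -- that the element n is enumerated, and decides the subcode of c₀ with number n.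
    module Generic {β₀ S₀} (c₀ : IsΣ⁰ τ β₀ S₀) (p₀ : Condition) where

      code : ℕ → Maybe Σ⁰Code
      code n = subcode (decodeList n) (β₀ , S₀ , c₀)

      step : ℕ → Condition → Condition
      step n = settle (code n) ∘ cover n ∘ grow

      stage : ℕ → Condition
      stage zero    = p₀
      stage (suc n) = step n (stage n)

      stage-≼-suc : ∀ n → stage n ≼ stage (suc n)
      stage-≼-suc n = extends-trans (update-extends _) (extends-trans (cover-≽ n _) (settle-≽ (code n) _))

      size-grows : ∀ n → suc (size (stage n)) ≤ size (stage (suc n))
      size-grows n = ℕ.≤-trans (proj₁ (cover-≽ n (grow (stage n)))) (proj₁ (settle-≽ (code n) (cover n (grow (stage n)))))

      size-stage : ∀ n → n ≤ size (stage n)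
      size-stage zero    = z≤n
      size-stage (suc n) = ℕ.≤-trans (s≤s (size-stage n)) (size-grows n)

      stage-mono : ∀ {n m} → n ≤ m → stage n ≼ stage m
      stage-mono {m = zero}  z≤n  = extends-refl
      stage-mono {m = suc m} n≤1+m with ℕ.m≤n⇒m<n∨m≡n n≤1+m
      ... | inj₁ n<1+m = extends-trans (stage-mono (ℕ.≤-pred n<1+m)) (stage-≼-suc m)
      ... | inj₂ refl  = extends-refl

      ⊩-stage-mono : ∀ {β S} (c : IsΣ⁰ τ β S) {n m} → n ≤ m → stage n ⊩ c → stage m ⊩ c
      ⊩-stage-mono c {n} {m} n≤m forces = ⊩-mono c {stage n} {stage m} forces (stage-mono n≤m)

      ⊩¬-stage-mono : ∀ {β S} (c : IsΣ⁰ τ β S) {n m} → n ≤ m → stage n ⊩¬ c → stage m ⊩¬ c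
      ⊩¬-stage-mono c {n} {m} n≤m forcesNot = ⊩¬-mono c {stage n} {stage m} forcesNot (stage-mono n≤m)

      stage-covers : ∀ n → ∃ λ j → j < size (stage (suc n)) × enum (stage (suc n)) j ≡ n
      stage-covers n with cover-covers n (grow (stage n))
      ... | j , j<k , covered = j , ℕ.<-≤-trans j<k (proj₁ settled) , trans (proj₂ settled j j<k) covered
        where
        settled = settle-≽ (code n) (cover n (grow (stage n)))

      stage-decides : ∀ path {β S} {c : IsΣ⁰ τ β S} → subcode path (β₀ , S₀ , c₀) ≡ just (β , S , c) →
        ∃ λ n → stage n ⊩ c ⊎ stage n ⊩¬ c
      stage-decides path {c = c} at-path = suc (encodeList path) , decides
        where
        decides : stage (suc (encodeList path)) ⊩ c ⊎ stage (suc (encodeList path)) ⊩¬ c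
        decides rewrite decodeList-encodeList path | at-path = settle-decides c _

      π : ℕ → ℕ
      π j = enum (stage (suc j)) j

      stage-agrees : ∀ n {j} → j < size (stage n) → enum (stage n) j ≡ π j
      stage-agrees n {j} j<k = ≼-agree {stage n} {stage (suc j)} {stage (n ⊔ suc j)} (stage-mono (ℕ.m≤m⊔n n (suc j))) (stage-mono (ℕ.m≤n⊔m n (suc j)))
        j<k (ℕ.<-≤-trans (ℕ.n<1+n j) (size-stage (suc j)))

      π-injective : ∀ {a b} → π a ≡ π b → a ≡ b
      π-injective {a} {b} eq = injective (stage N) a b a<N b<N
        (trans (stage-agrees N a<N) (trans eq (sym (stage-agrees N b<N))))
        where
        N = suc (a ⊔ b)
        a<N = ℕ.<-≤-trans (s≤s (ℕ.m≤m⊔n a b)) (size-stage N)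
        b<N = ℕ.<-≤-trans (s≤s (ℕ.m≤n⊔m a b)) (size-stage N)

      σ : ℕ → ℕ
      σ n = proj₁ (stage-covers n)

      π∘σ : ∀ n → π (σ n) ≡ n
      π∘σ n = trans (sym (stage-agrees (suc n) (proj₁ (proj₂ (stage-covers n))))) (proj₂ (proj₂ (stage-covers n)))

      σ∘π : ∀ j → σ (π j) ≡ j
      σ∘π j = π-injective (π∘σ (π j))

      copy : Struct τ
      copy = (λ a → diag A (rename π a)) , λ i j →
        ⇔-trans (proj₁ (proj₂ A (π i) (π j))) (mk⇔ π-injective (cong π)) ,
        ⇔-trans (proj₂ (proj₂ A (π i) (π j))) (mk⇔ (λ πi≢πj → πi≢πj ∘ cong π) (λ i≢j → i≢j ∘ π-injective))

      copy≅A : copy ≅ A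
      copy≅A = mk↔ₛ′ π σ π∘σ σ∘π , λ s v → refl

      A≅copy : A ≅ copy
      A≅copy = mk↔ₛ′ σ π σ∘π π∘σ , λ s v → cong (λ w → diag A (s , w)) (begin
        Vec.map π (Vec.map σ v) ≡⟨ Vec.map-∘ π σ v ⟨
        Vec.map (π ∘ σ) v       ≡⟨ Vec.map-cong π∘σ v ⟩
        Vec.map (λ n → n) v     ≡⟨ Vec.map-id v ⟩
        v                       ∎)
        where open ≡-Reasoning

      Decided : Σ⁰Code → Set₁
      Decided (β , S , c) = ∀ path {β′ S′} {c′ : IsΣ⁰ τ β′ S′} → subcode path (β , S , c) ≡ just (β′ , S′ , c′) →
        ∃ λ n → stage n ⊩ c′ ⊎ stage n ⊩¬ c′

      truth-lemma : ∀ {β S} (c : IsΣ⁰ τ β S) → Decided (β , S , c) → S copy ⇔ (∃ λ n → stage n ⊩ c)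
      truth-lemma (open₁ _ _ (P , S⇔)) _ = ⇔-trans (S⇔ copy) (mk⇔
        (λ (F , p , realized) → let (k , F<k) = bounded-exists F in
          k , injective (stage k) , F , p , bounded-mono (size-stage k) F<k
            , realize-agree A F<k (λ j j<k → stage-agrees k (ℕ.<-≤-trans j<k (size-stage k))) realized)
        (λ (n , _ , F , p , F<k , realized) → F , p , realize-agree A F<k (λ j j<k → sym (stage-agrees n j<k)) realized))
      truth-lemma u@(union _ _ _ _ C C′ c c′ S⇔) decided = ⇔-trans (S⇔ copy) (mk⇔ forced (λ (n , i , forces , forcesNot) →
        i , from (truth-lemma (c i) (decided-c i)) (n , forces) , λ inC′ →
          let (m , forces′) = to (truth-lemma (c′ i) (decided-c′ i)) inC′ in
          ⊩-⊩¬-disjoint (c′ i) {stage (n ⊔ m)} (⊩-stage-mono (c′ i) (ℕ.m≤n⊔m n m) forces′)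
                                              (⊩¬-stage-mono (c′ i) (ℕ.m≤m⊔n n m) forcesNot)))
        where
        decided-c : ∀ i → Decided (_ , C i , c i)
        decided-c i path = decided (pair 0 i ∷ path) ∘ trans (cong (λ d → child u d >>= subcode path) (unpair-pair 0 i))
        decided-c′ : ∀ i → Decided (_ , C′ i , c′ i)
        decided-c′ i path = decided (pair 1 i ∷ path) ∘ trans (cong (λ d → child u d >>= subcode path) (unpair-pair 1 i))
        forced : (∃ λ i → C i copy × ¬ C′ i copy) → ∃ λ n → stage n ⊩ u
        forced (i , inC , ∉C′) with to (truth-lemma (c i) (decided-c i)) inC | decided-c′ i [] refl
        ... | n , forces | N , inj₁ forces′ = ⊥-elim (∉C′ (from (truth-lemma (c′ i) (decided-c′ i)) (N , forces′)))
        ... | n , forces | N , inj₂ forcesNot =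
          n ⊔ N , i , ⊩-stage-mono (c i) (ℕ.m≤m⊔n n N) forces , ⊩¬-stage-mono (c′ i) (ℕ.m≤n⊔m n N) forcesNot

      truth-lemma-root : S₀ copy ⇔ (∃ λ n → stage n ⊩ c₀)
      truth-lemma-root = truth-lemma c₀ stage-decides

    empty : Condition
    empty = condition 0 (val noVars) (λ _ _ ())

    invariant-Π⁰-forcing : (B : Pred τ) → IsoInvariant B → ∀ {β S} (c : IsΣ⁰ τ β S) →
      (∀ G → B G ⇔ (¬ S G)) → B A ⇔ (¬ ExtensionForces c 0 noVars)
    invariant-Π⁰-forcing B B-inv c B⇔∉S = mk⇔
      (λ inB (m , x , forces) → let open Generic c (condition (m + 0) _ (forces-injective c forces)) in
        to (B⇔∉S copy) (B-inv A copy A≅copy inB) (from truth-lemma-root (0 , forces)))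
      (λ ¬ext → let open Generic c empty in
        B-inv copy A copy≅A (from (B⇔∉S copy) λ inS →
          let (n , forces) = to truth-lemma-root inS in
          from (forcesNot⇔¬extensionForces c 0 noVars) ¬ext _ _ (stage-mono {0} {n} z≤n) forces))

  Π⁰⇒Πᵖ : (B : Pred τ) → IsoInvariant B → ∀ {α} → IsΠ⁰ τ α B → Σ (PiP τ α 0) (λ φ → ∀ A → B A ⇔ ModΠ φ A)
  Π⁰⇒Πᵖ B B-inv (S , c , B⇔∉S) = noExtensionForcesΠ c 0 , λ A → let open Forcing A in
    ⇔-trans (invariant-Π⁰-forcing B B-inv c B⇔∉S)
      (⇔-trans (⇔-sym (forcesNot⇔¬extensionForces c 0 noVars)) (⇔-sym (noExtensionForcesΠ-correct c 0 noVars)))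

mainTheorem2 : ExcludedMiddle (lsuc lzero) →
    (τ : Vocabulary) (B : Pred τ) → IsoInvariant B →
    (α : Ord) → one ≤ₒ α →
    IsΠ⁰ τ α B ⇔ Σ (PiP τ α 0) (λ φ → ∀ (A : Struct τ) → B A ⇔ ModΠ φ A)
mainTheorem2 em τ B B-inv α one≤α = mk⇔ (Π⁰⇒Πᵖ B B-inv) (Πᵖ⇒Π⁰ one≤α B)
  where open Classical em τ
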